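{- For every integer $k\ge 1$, \[ \det\big(H_k(C)+H_k'(C)\big)=F_{2k+1}, \] where $H_k(C)=(C_{i+j-2})_{1\le i,j\le k}$ and $H_k'(C)=(C_{i+j-1})_{1\le i,j\le k}$.
   Context: $C_n$ denotes the $n$-th Catalan number ($C_0=1$, $C_{n+1}=\sum_{i=0}^n C_iC_{n-i}$). $F_n$ denotes the $n$-th Fibonacci number ($F_0=0$, $F_1=1$, $F_{n+1}=F_n+F_{n-1}$). $H_k(C)$ and $H_k'(C)$ are the Hankel matrices of the Catalan sequence. -}

module Defs where

open import Data.Nat using (ℕ; zero; suc; _+_; _*_)
open import Data.Fin using (Fin; zero; suc; toℕ; punchIn)
open import Data.Integer using (ℤ; +_; -_) renaming (_+_ to _+ℤ_; _*_ to _*ℤ_)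

open import Data.List using (List; []; _∷_; reverse; zipWith; head)
open import Data.Nat.ListAction using (sum)
open import Data.Maybe using (fromMaybe)

-- catRev n = C n ∷ C (n-1) ∷ ... ∷ C 0 ∷ []
catRev : ℕ → List ℕ
catRev zero = 1 ∷ []
catRev (suc n) = sum (zipWith _*_ (catRev n) (reverse (catRev n))) ∷ catRev n

catalan : ℕ → ℕ
catalan n = fromMaybe 0 (head (catRev n))

fib : ℕ → ℕ
fib zero = 0
fib (suc zero) = 1
fib (suc (suc n)) = fib (suc n) + fib n

Matrix : ℕ → Set
Matrix n = Fin n → Fin n → ℤ

sumFin : (n : ℕ) → (Fin n → ℤ) → ℤ
sumFin zero f = + 0
sumFin (suc n) f = f zero +ℤ sumFin n (λ i → f (suc i))

sgn : ℕ → ℤ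
sgn zero = + 1
sgn (suc j) = - sgn j

minor : {n : ℕ} → Matrix (suc n) → Fin (suc n) → Matrix n
minor M j r c = M (suc r) (punchIn j c)

det : (n : ℕ) → Matrix n → ℤ
det zero M = + 1
det (suc n) M = sumFin (suc n) (λ j → sgn (toℕ j) *ℤ M zero j *ℤ det n (minor M j))

-- Hankel matrices with 0-based indices i,j ∈ {0..k-1}:
-- H_k(C)_{ij} = C_{i+j},  H'_k(C)_{ij} = C_{i+j+1}
-- (matches the paper's 1-based (C_{i+j-2}) and (C_{i+j-1}))
hankel : (k : ℕ) → Matrix k
hankel k i j = + catalan (toℕ i + toℕ j)

hankel' : (k : ℕ) → Matrix k
hankel' k i j = + catalan (suc (toℕ i + toℕ j))

_⊕_ : {k : ℕ} → Matrix k → Matrix k → Matrix k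
(A ⊕ B) i j = A i j +ℤ B i j

-- The Catalan Hankel matrix factors as H_k(C) = B Bᵀ, where the ballot-number matrix B is unit
-- lower triangular and each row of B is the previous one times the tridiagonal matrix J with
-- diagonal 1, 2, 2, … and ones beside it (J is symmetric, which makes B Bᵀ a Hankel matrix).
-- Hence H_k(C) + H_k′(C) = B (I + J) Bᵀ and its determinant is that of the tridiagonal matrix
-- I + J, which satisfies the three-term recurrence of F_{2k+1}. The determinant (Laplace
-- expansion along the first row) is multilinear and alternating in rows and in columns, which is
-- what makes it invariant under unitriangular factors.
module Submission where

open import Data.Empty using (⊥-elim)
open import Data.Fin.Base as Fin using (Fin; toℕ)
open import Data.Integer.Base using (ℤ; +_; -[1+_]; -_; _+_; _*_; _-_)
open import Data.Integer.Properties hiding (_≟_; _<?_)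
open import Algebra.Properties.CommutativeSemigroup +-commutativeSemigroup
  using () renaming (interchange to +-interchange)
open import Data.Integer.Tactic.RingSolver using (solve-∀)
open import Data.List.Base using (_∷_; _∷ʳ_; reverse; zipWith; applyUpTo; applyDownFrom)
open import Data.List.Properties using (unfold-reverse; applyUpTo-∷ʳ)
open import Data.Nat.Base as ℕ using (ℕ; zero; suc; z≤n; s≤s; _∸_; _<_; _≤_)
open import Data.Nat.ListAction using (sum)
open import Data.Nat.Properties using (_≟_; _<?_)
import Data.Nat.Properties as ℕₚ
open import Data.Nat.Tactic.RingSolver using () renaming (solve-∀ to ℕ-solve-∀)
open import Function.Base using (_∘_; _⟨_⟩_)
open import Relation.Binary.Definitions using (tri<; tri≈; tri>)
open import Relation.Binary.PropositionalEquality
  using (_≡_; _≢_; refl; sym; trans; cong; cong₂; subst; module ≡-Reasoning)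
open import Relation.Nullary using (Dec; yes; no)

open import Defs

-- Sums over initial segments of ℕ

∑ : ℕ → (ℕ → ℤ) → ℤ
∑ zero    f = + 0
∑ (suc n) f = f 0 + ∑ n (f ∘ suc)

infixr 5 ∑
syntax ∑ n (λ i → e) = ∑[ i < n ] e

∑-cong : ∀ n {f g : ℕ → ℤ} → (∀ i → i < n → f i ≡ g i) → ∑ n f ≡ ∑ n g
∑-cong zero    f≡g = refl
∑-cong (suc n) f≡g = cong₂ _+_ (f≡g 0 (s≤s z≤n)) (∑-cong n (λ i i<n → f≡g (suc i) (s≤s i<n)))

∑-zero : ∀ n (f : ℕ → ℤ) → (∀ i → i < n → f i ≡ + 0) → ∑ n f ≡ + 0
∑-zero zero    f f≡0 = refl
∑-zero (suc n) f f≡0 =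
  cong₂ _+_ (f≡0 0 (s≤s z≤n)) (∑-zero n (f ∘ suc) (λ i i<n → f≡0 (suc i) (s≤s i<n)))

∑-distrib-+ : ∀ n (f g : ℕ → ℤ) → ∑[ i < n ] (f i + g i) ≡ ∑ n f + ∑ n g
∑-distrib-+ zero    f g = refl
∑-distrib-+ (suc n) f g = begin
  f 0 + g 0 + (∑[ i < n ] (f (suc i) + g (suc i)))
    ≡⟨ cong (_+_ (f 0 + g 0)) (∑-distrib-+ n (f ∘ suc) (g ∘ suc)) ⟩
  f 0 + g 0 + (∑ n (f ∘ suc) + ∑ n (g ∘ suc))
    ≡⟨ +-interchange (f 0) (g 0) _ _ ⟩
  f 0 + ∑ n (f ∘ suc) + (g 0 + ∑ n (g ∘ suc))
    ∎
  where open ≡-Reasoning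

*-distribˡ-∑ : ∀ n a (f : ℕ → ℤ) → a * ∑ n f ≡ ∑[ i < n ] (a * f i)
*-distribˡ-∑ zero    a f = *-zeroʳ a
*-distribˡ-∑ (suc n) a f =
  *-distribˡ-+ a (f 0) _ ⟨ trans ⟩ cong (_+_ (a * f 0)) (*-distribˡ-∑ n a (f ∘ suc))

*-distribʳ-∑ : ∀ n a (f : ℕ → ℤ) → ∑ n f * a ≡ ∑[ i < n ] (f i * a)
*-distribʳ-∑ n a f =
  *-comm (∑ n f) a ⟨ trans ⟩ *-distribˡ-∑ n a f ⟨ trans ⟩ ∑-cong n (λ i _ → *-comm a (f i))

∑-linear : ∀ n a b (f g : ℕ → ℤ) → ∑[ i < n ] (a * f i + b * g i) ≡ a * ∑ n f + b * ∑ n g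
∑-linear n a b f g =
  ∑-distrib-+ n (λ i → a * f i) (λ i → b * g i)
  ⟨ trans ⟩ sym (cong₂ _+_ (*-distribˡ-∑ n a f) (*-distribˡ-∑ n b g))

neg-distrib-∑ : ∀ n (f : ℕ → ℤ) → - ∑ n f ≡ ∑[ i < n ] - f i
neg-distrib-∑ zero    f = refl
neg-distrib-∑ (suc n) f = neg-distrib-+ (f 0) _ ⟨ trans ⟩ cong (_+_ (- f 0)) (neg-distrib-∑ n (f ∘ suc))

∑-comm : ∀ m n (F : ℕ → ℕ → ℤ) → ∑[ i < m ] ∑[ j < n ] F i j ≡ ∑[ j < n ] ∑[ i < m ] F i j
∑-comm zero    n F = sym (∑-zero n (λ _ → + 0) (λ _ _ → refl))
∑-comm (suc m) n F = cong (_+_ (∑[ j < n ] F 0 j)) (∑-comm m n (F ∘ suc)) ⟨ trans ⟩ sym (∑-distrib-+ n (F 0) _)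

∑-init-last : ∀ n (f : ℕ → ℤ) → ∑ (suc n) f ≡ ∑ n f + f n
∑-init-last zero    f = +-comm (f 0) (+ 0)
∑-init-last (suc n) f = cong (_+_ (f 0)) (∑-init-last n (f ∘ suc)) ⟨ trans ⟩ sym (+-assoc (f 0) _ (f (suc n)))

∑-truncate : ∀ m n (f : ℕ → ℤ) → m ≤ n → (∀ i → m ≤ i → f i ≡ + 0) → ∑ n f ≡ ∑ m f
∑-truncate m n f m≤n f≡0 = cong (λ k → ∑ k f) (sym (ℕₚ.m∸n+n≡m m≤n)) ⟨ trans ⟩ padding (n ∸ m)
  where
  padding : ∀ d → ∑ (d ℕ.+ m) f ≡ ∑ m f
  padding zero    = refl
  padding (suc d) =
    ∑-init-last (d ℕ.+ m) f
    ⟨ trans ⟩ cong₂ _+_ (padding d) (f≡0 (d ℕ.+ m) (ℕₚ.m≤n+m m d)) ⟨ trans ⟩ +-identityʳ (∑ m f)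

-- ℕ-analogues of Fin.punchIn and Fin.punchOut; punchOut j j is a junk value.
punchIn : ℕ → ℕ → ℕ
punchIn zero    c       = suc c
punchIn (suc j) zero    = zero
punchIn (suc j) (suc c) = suc (punchIn j c)

punchOut : ℕ → ℕ → ℕ
punchOut zero    t       = ℕ.pred t
punchOut (suc j) zero    = zero
punchOut (suc j) (suc t) = suc (punchOut j t)

punchInᵢ≢i : ∀ j c → punchIn j c ≢ j
punchInᵢ≢i (suc j) (suc c) eq = punchInᵢ≢i j c (ℕₚ.suc-injective eq)

punchIn-injective : ∀ j c c′ → punchIn j c ≡ punchIn j c′ → c ≡ c′
punchIn-injective zero    c       c′       eq = ℕₚ.suc-injective eq
punchIn-injective (suc j) zero    zero     eq = refl
punchIn-injective (suc j) (suc c) (suc c′) eq = cong suc (punchIn-injective j c c′ (ℕₚ.suc-injective eq))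

punchIn-< : ∀ n j c → c < n → punchIn j c < suc n
punchIn-< n       zero    c       c<n       = s≤s c<n
punchIn-< (suc n) (suc j) zero    c<n       = s≤s z≤n
punchIn-< (suc n) (suc j) (suc c) (s≤s c<n) = s≤s (punchIn-< n j c c<n)

punchIn-punchOut : ∀ j t → t ≢ j → punchIn j (punchOut j t) ≡ t
punchIn-punchOut zero    zero    t≢j = ⊥-elim (t≢j refl)
punchIn-punchOut zero    (suc t) t≢j = refl
punchIn-punchOut (suc j) zero    t≢j = refl
punchIn-punchOut (suc j) (suc t) t≢j = cong suc (punchIn-punchOut j t (t≢j ∘ cong suc))

punchOut-punchIn : ∀ j c → punchOut j (punchIn j c) ≡ c
punchOut-punchIn zero    c       = refl
punchOut-punchIn (suc j) zero    = refl
punchOut-punchIn (suc j) (suc c) = cong suc (punchOut-punchIn j c)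

punchIn-≢ : ∀ j t c → c ≢ punchOut j t → punchIn j c ≢ t
punchIn-≢ j t c c≢t eq = c≢t (sym (punchOut-punchIn j c) ⟨ trans ⟩ cong (punchOut j) eq)

punchOut-< : ∀ n j t → j < suc n → t < suc n → t ≢ j → punchOut j t < n
punchOut-< n       zero    zero    _         _         t≢j = ⊥-elim (t≢j refl)
punchOut-< n       zero    (suc t) _         (s≤s t<n) _   = t<n
punchOut-< zero    (suc j) t       (s≤s ())  _         _
punchOut-< (suc n) (suc j) zero    _         _         _   = s≤s z≤n
punchOut-< (suc n) (suc j) (suc t) (s≤s j<n) (s≤s t<n) t≢j = s≤s (punchOut-< n j t j<n t<n (t≢j ∘ cong suc))

punchOut-suc : ∀ j t → j ≢ t → j ≢ suc t → punchOut j (suc t) ≡ suc (punchOut j t)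
punchOut-suc zero          zero    j≢t _      = ⊥-elim (j≢t refl)
punchOut-suc zero          (suc t) _   _      = refl
punchOut-suc (suc zero)    zero    _   j≢1+t = ⊥-elim (j≢1+t refl)
punchOut-suc (suc (suc j)) zero    _   _      = refl
punchOut-suc (suc j)       (suc t) j≢t j≢1+t =
  cong suc (punchOut-suc j t (j≢t ∘ cong suc) (j≢1+t ∘ cong suc))

punchIn-self : ∀ t → punchIn t t ≡ suc t
punchIn-self zero    = refl
punchIn-self (suc t) = cong suc (punchIn-self t)

punchIn-suc-self : ∀ t → punchIn (suc t) t ≡ t
punchIn-suc-self zero    = refl
punchIn-suc-self (suc t) = cong suc (punchIn-suc-self t)

punchIn-suc : ∀ t c → c ≢ t → punchIn (suc t) c ≡ punchIn t c
punchIn-suc zero    zero    c≢t = ⊥-elim (c≢t refl)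
punchIn-suc zero    (suc c) _   = refl
punchIn-suc (suc t) zero    _   = refl
punchIn-suc (suc t) (suc c) c≢t = cong suc (punchIn-suc t c (c≢t ∘ cong suc))

-- Deleting columns a and b from a matrix, in either order.
punchIn-punchIn-comm : ∀ a b c → a ≢ b →
  punchIn a (punchIn (punchOut a b) c) ≡ punchIn b (punchIn (punchOut b a) c)
punchIn-punchIn-comm zero    zero    c       a≢b = ⊥-elim (a≢b refl)
punchIn-punchIn-comm zero    (suc b) c       _   = refl
punchIn-punchIn-comm (suc a) zero    c       _   = refl
punchIn-punchIn-comm (suc a) (suc b) zero    _   = refl
punchIn-punchIn-comm (suc a) (suc b) (suc c) a≢b = cong suc (punchIn-punchIn-comm a b c (a≢b ∘ cong suc))

∑-punchIn : ∀ n t (f : ℕ → ℤ) → t < suc n → ∑ (suc n) f ≡ f t + (∑[ i < n ] f (punchIn t i))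
∑-punchIn n       zero    f _         = refl
∑-punchIn zero    (suc t) f (s≤s ())
∑-punchIn (suc n) (suc t) f (s≤s t<n) =
  cong (_+_ (f 0)) (∑-punchIn n t (f ∘ suc) t<n) ⟨ trans ⟩ +-left-comm (f 0) (f (suc t)) _
  where
  +-left-comm : ∀ x y z → x + (y + z) ≡ y + (x + z)
  +-left-comm = solve-∀

∑-single : ∀ n t (f : ℕ → ℤ) → t < n → (∀ i → i < n → i ≢ t → f i ≡ + 0) → ∑ n f ≡ f t
∑-single (suc n) t f t<n f≡0 = begin
  ∑ (suc n) f                         ≡⟨ ∑-punchIn n t f t<n ⟩
  f t + (∑[ i < n ] f (punchIn t i))  ≡⟨ cong (_+_ (f t)) (∑-zero n _ vanish) ⟩
  f t + + 0                           ≡⟨ +-identityʳ (f t) ⟩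
  f t                                 ∎
  where
  open ≡-Reasoning
  vanish : ∀ i → i < n → f (punchIn t i) ≡ + 0
  vanish i i<n = f≡0 _ (punchIn-< n t i i<n) (punchInᵢ≢i t i)

∑-pair : ∀ n t (f : ℕ → ℤ) → suc t < n → (∀ i → i < n → i ≢ t → i ≢ suc t → f i ≡ + 0) →
         ∑ n f ≡ f t + f (suc t)
∑-pair (suc n) t f (s≤s t<n) f≡0 = begin
  ∑ (suc n) f                         ≡⟨ ∑-punchIn n t f (ℕₚ.m<n⇒m<1+n t<n) ⟩
  f t + (∑[ i < n ] f (punchIn t i))  ≡⟨ cong (_+_ (f t)) (∑-single n t _ t<n vanish) ⟩
  f t + f (punchIn t t)               ≡⟨ cong (λ c → f t + f c) (punchIn-self t) ⟩
  f t + f (suc t)                     ∎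
  where
  open ≡-Reasoning
  vanish : ∀ i → i < n → i ≢ t → f (punchIn t i) ≡ + 0
  vanish i i<n i≢t = f≡0 _ (punchIn-< n t i i<n) (punchInᵢ≢i t i)
    (λ eq → i≢t (punchIn-injective t i t (eq ⟨ trans ⟩ sym (punchIn-self t))))

-- Determinants by Laplace expansion

-- Matrices are indexed by ℕ; an n × n determinant only reads the top-left n × n corner.
Mat : Set
Mat = ℕ → ℕ → ℤ

_≈[_]_ : Mat → ℕ → Mat → Set
M ≈[ n ] N = ∀ r c → r < n → c < n → M r c ≡ N r c

transpose : Mat → Mat
transpose M r c = M c r

SameOffRow : ℕ → Mat → Mat → Set
SameOffRow t M N = ∀ r c → r ≢ t → M r c ≡ N r c

minor′ : ℕ → Mat → Mat
minor′ j M r c = M (suc r) (punchIn j c)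

det′ : ℕ → Mat → ℤ
laplaceTerm : ℕ → Mat → ℕ → ℤ

det′ zero    M = + 1
det′ (suc n) M = ∑ (suc n) (laplaceTerm n M)

laplaceTerm n M j = sgn j * M 0 j * det′ n (minor′ j M)

det′-cong : ∀ n {M N} → M ≈[ n ] N → det′ n M ≡ det′ n N
det′-cong zero    M≈N = refl
det′-cong (suc n) M≈N = ∑-cong (suc n) λ j j<n →
  cong₂ (λ x d → sgn j * x * d) (M≈N 0 j (s≤s z≤n) j<n)
    (det′-cong n λ r c r<n c<n → M≈N (suc r) (punchIn j c) (s≤s r<n) (punchIn-< n j c c<n))

det≡det′ : ∀ n (M : Mat) → det n (λ i j → M (toℕ i) (toℕ j)) ≡ det′ n M
det≡det′ zero    M = refl
det≡det′ (suc n) M =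
  sumFin-cong (suc n) (λ j → cong (λ d → sgn (toℕ j) * M 0 (toℕ j) * d)
    (det-cong n (λ r c → cong (M (suc (toℕ r))) (toℕ-punchIn j c))
     ⟨ trans ⟩ det≡det′ n (minor′ (toℕ j) M)))
  ⟨ trans ⟩ sumFin-toℕ (suc n) (laplaceTerm n M)
  where
  sumFin-cong : ∀ k {f g : Fin k → ℤ} → (∀ j → f j ≡ g j) → sumFin k f ≡ sumFin k g
  sumFin-cong zero    f≡g = refl
  sumFin-cong (suc k) f≡g = cong₂ _+_ (f≡g Fin.zero) (sumFin-cong k (f≡g ∘ Fin.suc))

  sumFin-toℕ : ∀ k (g : ℕ → ℤ) → sumFin k (g ∘ toℕ) ≡ ∑ k g
  sumFin-toℕ zero    g = refl
  sumFin-toℕ (suc k) g = cong (_+_ (g 0)) (sumFin-toℕ k (g ∘ suc))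

  det-cong : ∀ k {A B : Matrix k} → (∀ i j → A i j ≡ B i j) → det k A ≡ det k B
  det-cong zero    A≡B = refl
  det-cong (suc k) A≡B = sumFin-cong (suc k) λ j →
    cong₂ (λ x d → sgn (toℕ j) * x * d) (A≡B Fin.zero j)
      (det-cong k λ r c → A≡B (Fin.suc r) (Fin.punchIn j c))

  toℕ-punchIn : ∀ {k} (j : Fin (suc k)) (c : Fin k) → toℕ (Fin.punchIn j c) ≡ punchIn (toℕ j) (toℕ c)
  toℕ-punchIn Fin.zero    c           = refl
  toℕ-punchIn (Fin.suc j) Fin.zero    = refl
  toℕ-punchIn (Fin.suc j) (Fin.suc c) = cong suc (toℕ-punchIn j c)

det′-by-terms : ∀ n a b (M N P : Mat) →
  (∀ j → j < suc n → laplaceTerm n M j ≡ a * laplaceTerm n N j + b * laplaceTerm n P j) →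
  det′ (suc n) M ≡ a * det′ (suc n) N + b * det′ (suc n) P
det′-by-terms n a b M N P terms =
  ∑-cong (suc n) terms ⟨ trans ⟩ ∑-linear (suc n) a b (laplaceTerm n N) (laplaceTerm n P)

laplaceTerm-linear-entry : ∀ n j a b (M N P : Mat) → M 0 j ≡ a * N 0 j + b * P 0 j →
  det′ n (minor′ j M) ≡ det′ n (minor′ j N) → det′ n (minor′ j M) ≡ det′ n (minor′ j P) →
  laplaceTerm n M j ≡ a * laplaceTerm n N j + b * laplaceTerm n P j
laplaceTerm-linear-entry n j a b M N P M₀ⱼ dN dP = begin
  sgn j * M 0 j * det′ n (minor′ j M)                          ≡⟨ cong (λ x → sgn j * x * _) M₀ⱼ ⟩
  sgn j * (a * N 0 j + b * P 0 j) * det′ n (minor′ j M)        ≡⟨ distrib (sgn j) (N 0 j) (P 0 j) _ a b ⟩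
  a * (sgn j * N 0 j * det′ n (minor′ j M)) + b * (sgn j * P 0 j * det′ n (minor′ j M))
    ≡⟨ cong₂ (λ d e → a * (sgn j * N 0 j * d) + b * (sgn j * P 0 j * e)) dN dP ⟩
  a * laplaceTerm n N j + b * laplaceTerm n P j                ∎
  where
  open ≡-Reasoning
  distrib : ∀ s x y d a b → s * (a * x + b * y) * d ≡ a * (s * x * d) + b * (s * y * d)
  distrib = solve-∀

laplaceTerm-linear-minor : ∀ n j a b (M N P : Mat) → M 0 j ≡ N 0 j → M 0 j ≡ P 0 j →
  det′ n (minor′ j M) ≡ a * det′ n (minor′ j N) + b * det′ n (minor′ j P) →
  laplaceTerm n M j ≡ a * laplaceTerm n N j + b * laplaceTerm n P j
laplaceTerm-linear-minor n j a b M N P N₀ⱼ P₀ⱼ dM = begin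
  sgn j * M 0 j * det′ n (minor′ j M)                                     ≡⟨ cong (sgn j * M 0 j *_) dM ⟩
  sgn j * M 0 j * (a * det′ n (minor′ j N) + b * det′ n (minor′ j P))    ≡⟨ distrib (sgn j * M 0 j) _ _ a b ⟩
  a * (sgn j * M 0 j * det′ n (minor′ j N)) + b * (sgn j * M 0 j * det′ n (minor′ j P))
    ≡⟨ cong₂ (λ x y → a * (sgn j * x * _) + b * (sgn j * y * _)) N₀ⱼ P₀ⱼ ⟩
  a * laplaceTerm n N j + b * laplaceTerm n P j                           ∎
  where
  open ≡-Reasoning
  distrib : ∀ x d e a b → x * (a * d + b * e) ≡ a * (x * d) + b * (x * e)
  distrib = solve-∀

det′-linear-row : ∀ n t a b (M N P : Mat) → t < n → SameOffRow t M N → SameOffRow t M P →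
  (∀ c → M t c ≡ a * N t c + b * P t c) → det′ n M ≡ a * det′ n N + b * det′ n P
det′-linear-row (suc n) zero a b M N P _ M~N M~P Mₜ = det′-by-terms n a b M N P λ j _ →
  laplaceTerm-linear-entry n j a b M N P (Mₜ j)
    (det′-cong n λ r c _ _ → M~N (suc r) (punchIn j c) λ ())
    (det′-cong n λ r c _ _ → M~P (suc r) (punchIn j c) λ ())
det′-linear-row (suc n) (suc t) a b M N P (s≤s t<n) M~N M~P Mₜ = det′-by-terms n a b M N P λ j _ →
  laplaceTerm-linear-minor n j a b M N P (M~N 0 j λ ()) (M~P 0 j λ ())
    (det′-linear-row n t a b (minor′ j M) (minor′ j N) (minor′ j P) t<n
      (λ r c r≢t → M~N (suc r) (punchIn j c) (r≢t ∘ ℕₚ.suc-injective))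
      (λ r c r≢t → M~P (suc r) (punchIn j c) (r≢t ∘ ℕₚ.suc-injective))
      (Mₜ ∘ punchIn j))

det′-linear-col : ∀ n t a b (M N P : Mat) → t < n →
  SameOffRow t (transpose M) (transpose N) → SameOffRow t (transpose M) (transpose P) →
  (∀ r → M r t ≡ a * N r t + b * P r t) → det′ n M ≡ a * det′ n N + b * det′ n P
det′-linear-col (suc n) t a b M N P t<n M~N M~P Mₜ = det′-by-terms n a b M N P term
  where
  term : ∀ j → j < suc n → laplaceTerm n M j ≡ a * laplaceTerm n N j + b * laplaceTerm n P j
  term j j<n with j ≟ t
  ... | yes refl = laplaceTerm-linear-entry n j a b M N P (Mₜ 0)
    (det′-cong n λ r c _ _ → M~N (punchIn j c) (suc r) (punchInᵢ≢i j c))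
    (det′-cong n λ r c _ _ → M~P (punchIn j c) (suc r) (punchInᵢ≢i j c))
  ... | no j≢t = laplaceTerm-linear-minor n j a b M N P (M~N j 0 j≢t) (M~P j 0 j≢t)
    (det′-linear-col n (punchOut j t) a b (minor′ j M) (minor′ j N) (minor′ j P)
      (punchOut-< n j t j<n t<n (j≢t ∘ sym))
      (λ c r c≢t → M~N (punchIn j c) (suc r) (punchIn-≢ j t c c≢t))
      (λ c r c≢t → M~P (punchIn j c) (suc r) (punchIn-≢ j t c c≢t))
      (λ r → subst (λ c → M (suc r) c ≡ a * N (suc r) c + b * P (suc r) c)
               (sym (punchIn-punchOut j t (j≢t ∘ sym))) (Mₜ (suc r))))

det′-zero-col : ∀ n t (M : Mat) → t < n → (∀ r → M r t ≡ + 0) → det′ n M ≡ + 0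
det′-zero-col n t M t<n Mᵣₜ≡0 =
  det′-linear-col n t (+ 0) (+ 0) M M M t<n (λ _ _ _ → refl) (λ _ _ _ → refl)
    (λ r → Mᵣₜ≡0 r ⟨ trans ⟩ sym (cong₂ _+_ (*-zeroˡ (M r t)) (*-zeroˡ (M r t))))
  ⟨ trans ⟩ cong₂ _+_ (*-zeroˡ (det′ n M)) (*-zeroˡ (det′ n M))

det′-adjacent-cols : ∀ n t (M : Mat) → suc t < n → (∀ r → M r t ≡ M r (suc t)) → det′ n M ≡ + 0
det′-adjacent-cols (suc n) t M 1+t<n Mₜ≡Mₜ₊₁ = begin
  ∑ (suc n) (laplaceTerm n M)                   ≡⟨ ∑-pair (suc n) t _ 1+t<n vanish ⟩
  laplaceTerm n M t + laplaceTerm n M (suc t)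
    ≡⟨ cong₂ (λ x e → sgn t * M 0 t * d + - sgn t * x * e) (sym (Mₜ≡Mₜ₊₁ 0)) sameMinor ⟩
  sgn t * M 0 t * d + - sgn t * M 0 t * d       ≡⟨ cancel (sgn t) (M 0 t) d ⟩
  + 0                                           ∎
  where
  open ≡-Reasoning
  d = det′ n (minor′ t M)

  cancel : ∀ s x d → s * x * d + - s * x * d ≡ + 0
  cancel = solve-∀

  sameMinor : det′ n (minor′ (suc t) M) ≡ d
  sameMinor = det′-cong n λ r c _ _ → entry r c (c ≟ t)
    where
    entry : ∀ r c → Dec (c ≡ t) → M (suc r) (punchIn (suc t) c) ≡ M (suc r) (punchIn t c)
    entry r c (yes refl) = cong (M (suc r)) (punchIn-suc-self c)
      ⟨ trans ⟩ Mₜ≡Mₜ₊₁ (suc r) ⟨ trans ⟩ cong (M (suc r)) (sym (punchIn-self c))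
    entry r c (no c≢t) = cong (M (suc r)) (punchIn-suc t c c≢t)

  vanish : ∀ j → j < suc n → j ≢ t → j ≢ suc t → laplaceTerm n M j ≡ + 0
  vanish j j<n j≢t j≢1+t =
    cong (sgn j * M 0 j *_) (det′-adjacent-cols n (punchOut j t) (minor′ j M) bound adjacent)
    ⟨ trans ⟩ *-zeroʳ (sgn j * M 0 j)
    where
    punchOut-1+t : punchOut j (suc t) ≡ suc (punchOut j t)
    punchOut-1+t = punchOut-suc j t j≢t j≢1+t

    bound : suc (punchOut j t) < n
    bound = subst (_< n) punchOut-1+t (punchOut-< n j (suc t) j<n 1+t<n (j≢1+t ∘ sym))

    adjacent : ∀ r → M (suc r) (punchIn j (punchOut j t)) ≡ M (suc r) (punchIn j (suc (punchOut j t)))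
    adjacent r = begin
      M (suc r) (punchIn j (punchOut j t))         ≡⟨ cong (M (suc r)) (punchIn-punchOut j t (j≢t ∘ sym)) ⟩
      M (suc r) t                                  ≡⟨ Mₜ≡Mₜ₊₁ (suc r) ⟩
      M (suc r) (suc t)                            ≡⟨ cong (M (suc r)) (punchIn-punchOut j (suc t) (j≢1+t ∘ sym)) ⟨
      M (suc r) (punchIn j (punchOut j (suc t)))   ≡⟨ cong (M (suc r) ∘ punchIn j) punchOut-1+t ⟩
      M (suc r) (punchIn j (suc (punchOut j t)))   ∎

sgn-punchOut-antisym : ∀ a b → a ≢ b → sgn a * sgn (punchOut a b) ≡ - (sgn b * sgn (punchOut b a))
sgn-punchOut-antisym zero    zero    a≢b = ⊥-elim (a≢b refl)
sgn-punchOut-antisym zero    (suc b) _   = lemma (sgn b)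
  where
  lemma : ∀ x → + 1 * x ≡ - (- x * + 1)
  lemma = solve-∀
sgn-punchOut-antisym (suc a) zero    _   = lemma (sgn a)
  where
  lemma : ∀ x → - x * + 1 ≡ - (+ 1 * x)
  lemma = solve-∀
sgn-punchOut-antisym (suc a) (suc b) a≢b =
  neg-cancel (sgn a) (sgn (punchOut a b)) ⟨ trans ⟩ sgn-punchOut-antisym a b (a≢b ∘ cong suc)
  ⟨ trans ⟩ cong -_ (sym (neg-cancel (sgn b) (sgn (punchOut b a))))
  where
  neg-cancel : ∀ x y → - x * - y ≡ x * y
  neg-cancel = solve-∀

i≡-i⇒i≡0 : ∀ i → i ≡ - i → i ≡ + 0
i≡-i⇒i≡0 (+ zero)  _  = refl
i≡-i⇒i≡0 (+ suc n) ()
i≡-i⇒i≡0 -[1+ n ]  ()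

-- Expanding along both rows writes the determinant as a sum over ordered pairs (a , b) of distinct
-- columns; when the two rows coincide the summand is antisymmetric in (a , b).
det′-equal-first-rows : ∀ n (M : Mat) → (∀ c → M 0 c ≡ M 1 c) → det′ (suc (suc n)) M ≡ + 0
det′-equal-first-rows n M M₀≡M₁ = ∑-cong N expandRow1 ⟨ trans ⟩ i≡-i⇒i≡0 total antisym
  where
  open ≡-Reasoning
  N = suc (suc n)

  doubleMinor : ℕ → ℕ → ℤ
  doubleMinor a b = det′ n (λ r c → M (suc (suc r)) (punchIn a (punchIn (punchOut a b) c)))

  pairTerm : ℕ → ℕ → ℤ
  pairTerm a b with a ≟ b
  ... | yes _ = + 0
  ... | no  _ = sgn a * sgn (punchOut a b) * (M 0 a * M 0 b) * doubleMinor a b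

  doubleMinor-sym : ∀ a b → a ≢ b → doubleMinor a b ≡ doubleMinor b a
  doubleMinor-sym a b a≢b = det′-cong n λ r c _ _ → cong (M (suc (suc r))) (punchIn-punchIn-comm a b c a≢b)

  total : ℤ
  total = ∑[ a < N ] ∑[ b < N ] pairTerm a b

  pairTerm-diag : ∀ a → pairTerm a a ≡ + 0
  pairTerm-diag a with a ≟ a
  ... | yes _   = refl
  ... | no a≢a = ⊥-elim (a≢a refl)

  pairTerm-punchIn : ∀ a l →
    pairTerm a (punchIn a l) ≡ sgn a * sgn l * (M 0 a * M 0 (punchIn a l)) * det′ n (minor′ l (minor′ a M))
  pairTerm-punchIn a l with a ≟ punchIn a l
  ... | yes eq = ⊥-elim (punchInᵢ≢i a l (sym eq))
  ... | no  _ rewrite punchOut-punchIn a l = refl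

  pairTerm-antisym : ∀ a b → pairTerm a b ≡ - pairTerm b a
  pairTerm-antisym a b with a ≟ b | b ≟ a
  ... | yes _  | yes _  = refl
  ... | yes eq | no b≢a = ⊥-elim (b≢a (sym eq))
  ... | no a≢b | yes eq = ⊥-elim (a≢b (sym eq))
  ... | no a≢b | no _ rewrite sgn-punchOut-antisym a b a≢b | doubleMinor-sym a b a≢b =
    lemma (sgn b * sgn (punchOut b a)) (M 0 a) (M 0 b) (doubleMinor b a)
    where
    lemma : ∀ s x y d → - s * (x * y) * d ≡ - (s * (y * x) * d)
    lemma = solve-∀

  expandRow1 : ∀ a → a < N → laplaceTerm (suc n) M a ≡ ∑[ b < N ] pairTerm a b
  expandRow1 a a<N = begin
    sgn a * M 0 a * ∑ (suc n) (laplaceTerm n (minor′ a M))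
      ≡⟨ *-distribˡ-∑ (suc n) (sgn a * M 0 a) (laplaceTerm n (minor′ a M)) ⟩
    ∑[ l < suc n ] (sgn a * M 0 a * laplaceTerm n (minor′ a M) l)
      ≡⟨ ∑-cong (suc n) (λ l _ → regroup l ⟨ trans ⟩ sym (pairTerm-punchIn a l)) ⟩
    ∑[ l < suc n ] pairTerm a (punchIn a l)
      ≡⟨ +-identityˡ _ ⟨
    + 0 + (∑[ l < suc n ] pairTerm a (punchIn a l))
      ≡⟨ cong (_+ (∑[ l < suc n ] pairTerm a (punchIn a l))) (pairTerm-diag a) ⟨
    pairTerm a a + (∑[ l < suc n ] pairTerm a (punchIn a l))
      ≡⟨ ∑-punchIn (suc n) a (pairTerm a) a<N ⟨
    ∑[ b < N ] pairTerm a b ∎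
    where
    regroup : ∀ l → sgn a * M 0 a * laplaceTerm n (minor′ a M) l
                  ≡ sgn a * sgn l * (M 0 a * M 0 (punchIn a l)) * det′ n (minor′ l (minor′ a M))
    regroup l =
      cong (λ y → sgn a * M 0 a * (sgn l * y * d)) (sym (M₀≡M₁ (punchIn a l)))
      ⟨ trans ⟩ lemma (sgn a) (M 0 a) (sgn l) (M 0 (punchIn a l)) d
      where
      d = det′ n (minor′ l (minor′ a M))
      lemma : ∀ sa x sl y d → sa * x * (sl * y * d) ≡ sa * sl * (x * y) * d
      lemma = solve-∀

  antisym : total ≡ - total
  antisym = begin
    ∑[ a < N ] ∑[ b < N ] pairTerm a b      ≡⟨ ∑-comm N N pairTerm ⟩
    ∑[ b < N ] ∑[ a < N ] pairTerm a b      ≡⟨ ∑-cong N (λ b _ → ∑-cong N λ a _ → pairTerm-antisym a b) ⟩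
    ∑[ b < N ] ∑[ a < N ] - pairTerm b a    ≡⟨ ∑-cong N (λ b _ → neg-distrib-∑ N (pairTerm b)) ⟨
    ∑[ b < N ] - (∑[ a < N ] pairTerm b a)  ≡⟨ neg-distrib-∑ N (λ b → ∑ N (pairTerm b)) ⟨
    - total                                 ∎

det′-adjacent-rows : ∀ n t (M : Mat) → suc t < n → (∀ c → M t c ≡ M (suc t) c) → det′ n M ≡ + 0
det′-adjacent-rows (suc (suc n)) zero    M _           Mₜ≡Mₜ₊₁ = det′-equal-first-rows n M Mₜ≡Mₜ₊₁
det′-adjacent-rows (suc n)       (suc t) M (s≤s 2+t<n) Mₜ≡Mₜ₊₁ =
  ∑-zero (suc n) (laplaceTerm n M) λ j _ →
  cong (sgn j * M 0 j *_) (det′-adjacent-rows n t (minor′ j M) 2+t<n (Mₜ≡Mₜ₊₁ ∘ punchIn j))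
  ⟨ trans ⟩ *-zeroʳ (sgn j * M 0 j)

-- Invariance under unitriangular factors

infixl 7 _·[_]_
_·[_]_ : Mat → ℕ → Mat → Mat
(A ·[ n ] B) r c = ∑[ m < n ] (A r m * B m c)

·-unitLowerTriangular-row : ∀ n t c (L M : Mat) → t < n → L t t ≡ + 1 → (∀ m → t < m → L t m ≡ + 0) →
  (L ·[ n ] M) t c ≡ M t c + (∑[ m < t ] (L t m * M m c))
·-unitLowerTriangular-row n t c L M t<n Lₜₜ≡1 Lₜₘ≡0 = begin
  ∑[ m < n ] (L t m * M m c)      ≡⟨ ∑-truncate (suc t) n _ t<n (λ m t<m → cong (_* M m c) (Lₜₘ≡0 m t<m)) ⟩
  ∑[ m < suc t ] (L t m * M m c)  ≡⟨ ∑-init-last t _ ⟩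
  S + L t t * M t c               ≡⟨ cong (λ x → S + x * M t c) Lₜₜ≡1 ⟩
  S + + 1 * M t c                 ≡⟨ cong (_+_ S) (*-identityˡ (M t c)) ⟩
  S + M t c                       ≡⟨ +-comm S (M t c) ⟩
  M t c + S                       ∎
  where
  open ≡-Reasoning
  S = ∑[ m < t ] (L t m * M m c)

module RowAlternating
  (n : ℕ) (D : Mat → ℤ)
  (D-cong : ∀ {M N} → M ≈[ n ] N → D M ≡ D N)
  (D-linear : ∀ t a b M N P → t < n → SameOffRow t M N → SameOffRow t M P →
              (∀ c → M t c ≡ a * N t c + b * P t c) → D M ≡ a * D N + b * D P)
  (D-adjacent : ∀ t M → suc t < n → (∀ c → M t c ≡ M (suc t) c) → D M ≡ + 0)
  where

  open ≡-Reasoning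

  setRow : ℕ → (ℕ → ℤ) → Mat → Mat
  setRow t v M r c with r ≟ t
  ... | yes _ = v c
  ... | no  _ = M r c

  setRow-≡ : ∀ t v M c → setRow t v M t c ≡ v c
  setRow-≡ t v M c with t ≟ t
  ... | yes _   = refl
  ... | no t≢t = ⊥-elim (t≢t refl)

  setRow-≢ : ∀ t v M → SameOffRow t (setRow t v M) M
  setRow-≢ t v M r c r≢t with r ≟ t
  ... | yes r≡t = ⊥-elim (r≢t r≡t)
  ... | no  _   = refl

  setRows : ℕ → (ℕ → ℤ) → (ℕ → ℤ) → Mat → Mat
  setRows t x y M = setRow t x (setRow (suc t) y M)

  setRows-fst : ∀ t x y M c → setRows t x y M t c ≡ x c
  setRows-fst t x y M = setRow-≡ t x _

  setRows-snd : ∀ t x y M c → setRows t x y M (suc t) c ≡ y c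
  setRows-snd t x y M c = setRow-≢ t x _ (suc t) c ℕₚ.1+n≢n ⟨ trans ⟩ setRow-≡ (suc t) y M c

  setRows-≢ : ∀ t x y M r c → r ≢ t → r ≢ suc t → setRows t x y M r c ≡ M r c
  setRows-≢ t x y M r c r≢t r≢1+t = setRow-≢ t x _ r c r≢t ⟨ trans ⟩ setRow-≢ (suc t) y M r c r≢1+t

  setRows-self : ∀ t M → setRows t (M t) (M (suc t)) M ≈[ n ] M
  setRows-self t M r c _ _ = byCases (r ≟ t) (r ≟ suc t)
    where
    byCases : Dec (r ≡ t) → Dec (r ≡ suc t) → setRows t (M t) (M (suc t)) M r c ≡ M r c
    byCases (yes refl) _          = setRows-fst r (M r) (M (suc r)) M c
    byCases (no _)     (yes refl) = setRows-snd t (M t) (M r) M c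
    byCases (no r≢t)   (no r≢1+t) = setRows-≢ t (M t) (M (suc t)) M r c r≢t r≢1+t

  D-additive : ∀ t M N P → t < n → SameOffRow t M N → SameOffRow t M P →
               (∀ c → M t c ≡ N t c + P t c) → D M ≡ D N + D P
  D-additive t M N P t<n M~N M~P Mₜ =
    D-linear t (+ 1) (+ 1) M N P t<n M~N M~P
      (λ c → Mₜ c ⟨ trans ⟩ sym (cong₂ _+_ (*-identityˡ (N t c)) (*-identityˡ (P t c))))
    ⟨ trans ⟩ cong₂ _+_ (*-identityˡ (D N)) (*-identityˡ (D P))

  D-setRows-antisym : ∀ t x y M → suc t < n → D (setRows t x y M) + D (setRows t y x M) ≡ + 0
  D-setRows-antisym t x y M 1+t<n = begin
    R x y + R y x                         ≡⟨ cong₂ _+_ (+-identityˡ (R x y)) (+-identityʳ (R y x)) ⟨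
    (+ 0 + R x y) + (R y x + + 0)         ≡⟨ cong₂ (λ p q → (p + R x y) + (R y x + q)) (adjacent x) (adjacent y) ⟨
    (R x x + R x y) + (R y x + R y y)     ≡⟨ cong₂ _+_ (additive₂ x x y) (additive₂ y x y) ⟨
    R x s + R y s                         ≡⟨ additive₁ x y s ⟨
    R s s                                 ≡⟨ adjacent s ⟩
    + 0                                   ∎
    where
    R : (ℕ → ℤ) → (ℕ → ℤ) → ℤ
    R u v = D (setRows t u v M)

    s : ℕ → ℤ
    s c = x c + y c

    t<n : t < n
    t<n = ℕₚ.<-trans (ℕₚ.n<1+n t) 1+t<n

    adjacent : ∀ u → R u u ≡ + 0
    adjacent u = D-adjacent t (setRows t u u M) 1+t<n λ c →
      setRows-fst t u u M c ⟨ trans ⟩ sym (setRows-snd t u u M c)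

    additive₁ : ∀ u v w → R (λ c → u c + v c) w ≡ R u w + R v w
    additive₁ u v w = D-additive t _ _ _ t<n (sameOffFst u) (sameOffFst v)
      λ c → setRows-fst t _ w M c ⟨ trans ⟩ sym (cong₂ _+_ (setRows-fst t u w M c) (setRows-fst t v w M c))
      where
      sameOffFst : ∀ u′ → SameOffRow t (setRows t (λ c → u c + v c) w M) (setRows t u′ w M)
      sameOffFst u′ r c r≢t = setRow-≢ t _ _ r c r≢t ⟨ trans ⟩ sym (setRow-≢ t u′ _ r c r≢t)

    additive₂ : ∀ u v w → R u (λ c → v c + w c) ≡ R u v + R u w
    additive₂ u v w = D-additive (suc t) _ _ _ 1+t<n (sameOffSnd v) (sameOffSnd w)
      λ c → setRows-snd t u _ M c ⟨ trans ⟩ sym (cong₂ _+_ (setRows-snd t u v M c) (setRows-snd t u w M c))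
      where
      sameOffSnd : ∀ v′ → SameOffRow (suc t) (setRows t u (λ c → v c + w c) M) (setRows t u v′ M)
      sameOffSnd v′ r c r≢1+t = byCases (r ≟ t)
        where
        byCases : Dec (r ≡ t) → setRows t u (λ c → v c + w c) M r c ≡ setRows t u v′ M r c
        byCases (yes refl) = setRows-fst r u _ M c ⟨ trans ⟩ sym (setRows-fst r u v′ M c)
        byCases (no r≢t)   =
          setRows-≢ t u _ M r c r≢t r≢1+t ⟨ trans ⟩ sym (setRows-≢ t u v′ M r c r≢t r≢1+t)

  -- Swapping rows b and b + 1 negates D and moves the copy of row a from b + 1 to b.
  D-equal-rows : ∀ a b M → a < b → b < n → (∀ c → M a c ≡ M b c) → D M ≡ + 0
  D-equal-rows a (suc b) M (s≤s a≤b) 1+b<n Mₐ≡M₁₊ᵦ with a ≟ b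
  ... | yes refl = D-adjacent a M 1+b<n Mₐ≡M₁₊ᵦ
  ... | no a≢b   = begin
    D M          ≡⟨ D-cong (setRows-self b M) ⟨
    D V          ≡⟨ +-identityʳ (D V) ⟨
    D V + + 0    ≡⟨ cong (_+_ (D V)) swappedVanishes ⟨
    D V + D W    ≡⟨ D-setRows-antisym b (M b) (M (suc b)) M 1+b<n ⟩
    + 0          ∎
    where
    V W : Mat
    V = setRows b (M b) (M (suc b)) M
    W = setRows b (M (suc b)) (M b) M

    swappedVanishes : D W ≡ + 0
    swappedVanishes =
      D-equal-rows a b W (ℕₚ.≤∧≢⇒< a≤b a≢b) (ℕₚ.<-trans (ℕₚ.n<1+n b) 1+b<n) λ c →
        setRows-≢ b _ _ M a c a≢b (ℕₚ.<⇒≢ (s≤s a≤b))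
        ⟨ trans ⟩ Mₐ≡M₁₊ᵦ c ⟨ trans ⟩ sym (setRows-fst b _ _ M c)

  D-add-lower-rows : ∀ K t (coef : ℕ → ℤ) (M M′ : Mat) → K ≤ t → t < n → SameOffRow t M M′ →
    (∀ c → M t c ≡ M′ t c + (∑[ m < K ] (coef m * M′ m c))) → D M ≡ D M′
  D-add-lower-rows zero t coef M M′ _ t<n M~M′ Mₜ = D-cong λ r c _ _ → byCases r c (r ≟ t)
    where
    byCases : ∀ r c → Dec (r ≡ t) → M r c ≡ M′ r c
    byCases r c (yes refl) = Mₜ c ⟨ trans ⟩ +-identityʳ (M′ r c)
    byCases r c (no r≢t)   = M~M′ r c r≢t
  D-add-lower-rows (suc K) t coef M M′ K<t t<n M~M′ Mₜ = begin
    D M                             ≡⟨ D-linear t (+ 1) (coef K) M M″ Z t<n sameOff sameOff Mₜ-split ⟩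
    + 1 * D M″ + coef K * D Z       ≡⟨ cong₂ (λ x y → + 1 * x + coef K * y) M″≈M′ Z-vanishes ⟩
    + 1 * D M′ + coef K * + 0       ≡⟨ lemma (D M′) (coef K) ⟩
    D M′                            ∎
    where
    partial : ℕ → ℤ
    partial c = M′ t c + (∑[ m < K ] (coef m * M′ m c))

    M″ Z : Mat
    M″ = setRow t partial M′
    Z  = setRow t (M′ K) M′

    sameOff : ∀ {v} → SameOffRow t M (setRow t v M′)
    sameOff r c r≢t = M~M′ r c r≢t ⟨ trans ⟩ sym (setRow-≢ t _ M′ r c r≢t)

    Mₜ-split : ∀ c → M t c ≡ + 1 * M″ t c + coef K * Z t c
    Mₜ-split c = begin
      M t c
        ≡⟨ Mₜ c ⟩
      M′ t c + (∑[ m < suc K ] (coef m * M′ m c))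
        ≡⟨ cong (_+_ (M′ t c)) (∑-init-last K _) ⟩
      M′ t c + ((∑[ m < K ] (coef m * M′ m c)) + coef K * M′ K c)
        ≡⟨ +-assoc (M′ t c) _ _ ⟨
      partial c + coef K * M′ K c
        ≡⟨ cong₂ (λ x y → x + coef K * y) (setRow-≡ t partial M′ c) (setRow-≡ t (M′ K) M′ c) ⟨
      M″ t c + coef K * Z t c
        ≡⟨ cong (_+ coef K * Z t c) (*-identityˡ (M″ t c)) ⟨
      + 1 * M″ t c + coef K * Z t c
        ∎

    M″≈M′ : D M″ ≡ D M′
    M″≈M′ = D-add-lower-rows K t coef M″ M′ (ℕₚ.<⇒≤ K<t) t<n
              (setRow-≢ t partial M′) (setRow-≡ t partial M′)

    Z-vanishes : D Z ≡ + 0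
    Z-vanishes = D-equal-rows K t Z K<t t<n λ c →
      setRow-≢ t (M′ K) M′ K c (ℕₚ.<⇒≢ K<t) ⟨ trans ⟩ sym (setRow-≡ t (M′ K) M′ c)

    lemma : ∀ d k → + 1 * d + k * + 0 ≡ d
    lemma = solve-∀

  D-unitLowerTriangular : ∀ (L M : Mat) →
    (∀ r → r < n → L r r ≡ + 1) → (∀ r m → r < m → L r m ≡ + 0) → D (L ·[ n ] M) ≡ D M
  D-unitLowerTriangular L M Lᵣᵣ≡1 Lᵣₘ≡0 =
    D-cong (λ r c _ _ → sym (mixed-≥ 0 r c z≤n))
    ⟨ trans ⟩ step* n ℕₚ.≤-refl
    ⟨ trans ⟩ D-cong (λ r c r<n _ → mixed-< n r c r<n)
    where
    -- Interpolates between L · M (t = 0) and M (t = n), one row at a time.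
    mixed : ℕ → Mat
    mixed t r c with r <? t
    ... | yes _ = M r c
    ... | no  _ = (L ·[ n ] M) r c

    mixed-< : ∀ t r c → r < t → mixed t r c ≡ M r c
    mixed-< t r c r<t with r <? t
    ... | yes _   = refl
    ... | no r≮t = ⊥-elim (r≮t r<t)

    mixed-≥ : ∀ t r c → t ≤ r → mixed t r c ≡ (L ·[ n ] M) r c
    mixed-≥ t r c t≤r with r <? t
    ... | yes r<t = ⊥-elim (ℕₚ.<⇒≱ r<t t≤r)
    ... | no  _   = refl

    step : ∀ t → t < n → D (mixed t) ≡ D (mixed (suc t))
    step t t<n = D-add-lower-rows t t (L t) (mixed t) (mixed (suc t)) ℕₚ.≤-refl t<n sameOff rowₜ
      where
      sameOff : SameOffRow t (mixed t) (mixed (suc t))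
      sameOff r c r≢t with ℕₚ.<-cmp r t
      ... | tri< r<t _ _ = mixed-< t r c r<t ⟨ trans ⟩ sym (mixed-< (suc t) r c (ℕₚ.m<n⇒m<1+n r<t))
      ... | tri≈ _ r≡t _ = ⊥-elim (r≢t r≡t)
      ... | tri> _ _ t<r = mixed-≥ t r c (ℕₚ.<⇒≤ t<r) ⟨ trans ⟩ sym (mixed-≥ (suc t) r c t<r)

      rowₜ : ∀ c → mixed t t c ≡ mixed (suc t) t c + (∑[ m < t ] (L t m * mixed (suc t) m c))
      rowₜ c = begin
        mixed t t c
          ≡⟨ mixed-≥ t t c ℕₚ.≤-refl ⟩
        (L ·[ n ] M) t c
          ≡⟨ ·-unitLowerTriangular-row n t c L M t<n (Lᵣᵣ≡1 t t<n) (Lᵣₘ≡0 t) ⟩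
        M t c + (∑[ m < t ] (L t m * M m c))
          ≡⟨ cong₂ _+_ (mixed-< (suc t) t c (ℕₚ.n<1+n t)) (∑-cong t λ m m<t →
               cong (L t m *_) (mixed-< (suc t) m c (ℕₚ.m<n⇒m<1+n m<t))) ⟨
        mixed (suc t) t c + (∑[ m < t ] (L t m * mixed (suc t) m c))
          ∎

    step* : ∀ t → t ≤ n → D (mixed 0) ≡ D (mixed t)
    step* zero    _     = refl
    step* (suc t) 1+t≤n = step* t (ℕₚ.<⇒≤ 1+t≤n) ⟨ trans ⟩ step t 1+t≤n

det′-unitLowerTriangular-· : ∀ n (L M : Mat) →
  (∀ r → r < n → L r r ≡ + 1) → (∀ r m → r < m → L r m ≡ + 0) → det′ n (L ·[ n ] M) ≡ det′ n M
det′-unitLowerTriangular-· n = RowAlternating.D-unitLowerTriangular n (det′ n)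
  (det′-cong n) (det′-linear-row n) (det′-adjacent-rows n)

det′-·-unitUpperTriangular : ∀ n (M U : Mat) →
  (∀ r → r < n → U r r ≡ + 1) → (∀ r c → c < r → U r c ≡ + 0) → det′ n (M ·[ n ] U) ≡ det′ n M
det′-·-unitUpperTriangular n M U Uᵣᵣ≡1 Uᵣ꜀≡0 =
  det′-cong n (λ r c _ _ → ∑-cong n λ m _ → *-comm (M r m) (U m c))
  ⟨ trans ⟩ Columns.D-unitLowerTriangular (transpose U) (transpose M) Uᵣᵣ≡1 (λ r m r<m → Uᵣ꜀≡0 m r r<m)
  where
  module Columns = RowAlternating n (det′ n ∘ transpose)
    (λ M≈N → det′-cong n λ r c r<n c<n → M≈N c r c<n r<n)
    (λ t a b M N P → det′-linear-col n t a b (transpose M) (transpose N) (transpose P))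
    (λ t M → det′-adjacent-cols n t (transpose M))

-- Tridiagonal determinants

det′-first-row-two : ∀ n (M : Mat) → (∀ j → M 0 (suc (suc j)) ≡ + 0) →
  det′ (suc (suc n)) M ≡ M 0 0 * det′ (suc n) (minor′ 0 M) - M 0 1 * det′ (suc n) (minor′ 1 M)
det′-first-row-two n M M₀ⱼ≡0 =
  cong (λ z → laplaceTerm (suc n) M 0 + (laplaceTerm (suc n) M 1 + z)) (∑-zero n _ vanish)
  ⟨ trans ⟩ lemma (M 0 0) (det′ (suc n) (minor′ 0 M)) (M 0 1) (det′ (suc n) (minor′ 1 M))
  where
  vanish : ∀ j → j < n → laplaceTerm (suc n) M (suc (suc j)) ≡ + 0
  vanish j _ = cong (λ x → sgn (suc (suc j)) * x * d) (M₀ⱼ≡0 j) ⟨ trans ⟩ zero-middle (sgn (suc (suc j))) d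
    where
    d = det′ (suc n) (minor′ (suc (suc j)) M)
    zero-middle : ∀ s d → s * + 0 * d ≡ + 0
    zero-middle = solve-∀

  lemma : ∀ x d y e → + 1 * x * d + (- + 1 * y * e + + 0) ≡ x * d - y * e
  lemma = solve-∀

-- Top-left entry a, the other diagonal entries b, and 1 next to the diagonal.
tridiag : ℕ → ℕ → Mat
tridiag a b (suc r)       (suc c)       = tridiag b b r c
tridiag a b zero          zero          = + a
tridiag a b zero          (suc zero)    = + 1
tridiag a b zero          (suc (suc c)) = + 0
tridiag a b (suc zero)    zero          = + 1
tridiag a b (suc (suc r)) zero          = + 0

tridiag-sym : ∀ a b r c → tridiag a b r c ≡ tridiag a b c r
tridiag-sym a b zero          zero          = refl
tridiag-sym a b zero          (suc zero)    = refl
tridiag-sym a b zero          (suc (suc c)) = refl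
tridiag-sym a b (suc zero)    zero          = refl
tridiag-sym a b (suc (suc r)) zero          = refl
tridiag-sym a b (suc r)       (suc c)       = tridiag-sym b b r c

det′-tridiag-minor₁ : ∀ a b n → det′ (suc n) (minor′ 1 (tridiag a b)) ≡ det′ n (tridiag b b)
det′-tridiag-minor₁ a b zero    = refl
det′-tridiag-minor₁ a b (suc n) =
  det′-first-row-two n (minor′ 1 (tridiag a b)) (λ _ → refl)
  ⟨ trans ⟩ cong (λ d → + 1 * det′ (suc n) (tridiag b b) - + 1 * d)
                 (det′-zero-col (suc n) 0 (minor′ 1 (minor′ 1 (tridiag a b))) (s≤s z≤n) (λ _ → refl))
  ⟨ trans ⟩ lemma (det′ (suc n) (tridiag b b))
  where
  lemma : ∀ d → + 1 * d - + 1 * + 0 ≡ d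
  lemma = solve-∀

det′-tridiag : ∀ a b n →
  det′ (suc (suc n)) (tridiag a b) ≡ + a * det′ (suc n) (tridiag b b) - det′ n (tridiag b b)
det′-tridiag a b n =
  det′-first-row-two n (tridiag a b) (λ _ → refl)
  ⟨ trans ⟩ cong (λ d → + a * det′ (suc n) (tridiag b b) - + 1 * d) (det′-tridiag-minor₁ a b n)
  ⟨ trans ⟩ cong (_-_ (+ a * det′ (suc n) (tridiag b b))) (*-identityˡ (det′ n (tridiag b b)))

fib-+3 : ∀ m → fib (3 ℕ.+ m) ℕ.+ fib m ≡ 2 ℕ.* fib (2 ℕ.+ m)
fib-+3 m = lemma (fib (suc m)) (fib m)
  where
  lemma : ∀ x y → ((x ℕ.+ y) ℕ.+ x) ℕ.+ y ≡ 2 ℕ.* (x ℕ.+ y)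
  lemma = ℕ-solve-∀

fib-+4 : ∀ m → fib (4 ℕ.+ m) ℕ.+ fib m ≡ 3 ℕ.* fib (2 ℕ.+ m)
fib-+4 m = lemma (fib (suc m)) (fib m)
  where
  lemma : ∀ x y → (((x ℕ.+ y) ℕ.+ x) ℕ.+ (x ℕ.+ y)) ℕ.+ y ≡ 3 ℕ.* (x ℕ.+ y)
  lemma = ℕ-solve-∀

fib-step : ∀ a k m → fib (k ℕ.+ m) ℕ.+ fib m ≡ a ℕ.* fib (2 ℕ.+ m) →
  + a * + fib (2 ℕ.+ m) - + fib m ≡ + fib (k ℕ.+ m)
fib-step a k m eq = begin
  + a * + fib (2 ℕ.+ m) - + fib m              ≡⟨ cong (_- + fib m) (pos-* a (fib (2 ℕ.+ m))) ⟨
  + (a ℕ.* fib (2 ℕ.+ m)) - + fib m            ≡⟨ cong (λ x → + x - + fib m) eq ⟨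
  + (fib (k ℕ.+ m) ℕ.+ fib m) - + fib m        ≡⟨ cong (_- + fib m) (pos-+ (fib (k ℕ.+ m)) (fib m)) ⟩
  + fib (k ℕ.+ m) + + fib m - + fib m          ≡⟨ lemma (+ fib (k ℕ.+ m)) (+ fib m) ⟩
  + fib (k ℕ.+ m)                              ∎
  where
  open ≡-Reasoning
  lemma : ∀ x y → x + y - y ≡ x
  lemma = solve-∀

2*[1+n]≡2+2*n : ∀ n → 2 ℕ.* suc n ≡ 2 ℕ.+ 2 ℕ.* n
2*[1+n]≡2+2*n n = ℕₚ.*-suc 2 n

2*[2+n]≡4+2*n : ∀ n → 2 ℕ.* suc (suc n) ≡ 4 ℕ.+ 2 ℕ.* n
2*[2+n]≡4+2*n n = 2*[1+n]≡2+2*n (suc n) ⟨ trans ⟩ cong (2 ℕ.+_) (2*[1+n]≡2+2*n n)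

det′-tridiag-3-3 : ∀ n → det′ n (tridiag 3 3) ≡ + fib (2 ℕ.+ 2 ℕ.* n)
det′-tridiag-3-3 zero          = refl
det′-tridiag-3-3 (suc zero)    = refl
det′-tridiag-3-3 (suc (suc n)) = begin
  det′ (suc (suc n)) T                       ≡⟨ det′-tridiag 3 3 n ⟩
  + 3 * det′ (suc n) T - det′ n T            ≡⟨ cong₂ (λ x y → + 3 * x - y) (det′-tridiag-3-3 (suc n)) (det′-tridiag-3-3 n) ⟩
  + 3 * + fib (2 ℕ.+ 2 ℕ.* suc n) - + fib m  ≡⟨ cong (λ i → + 3 * + fib (2 ℕ.+ i) - + fib m) (2*[1+n]≡2+2*n n) ⟩
  + 3 * + fib (2 ℕ.+ m) - + fib m            ≡⟨ fib-step 3 4 m (fib-+4 m) ⟩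
  + fib (4 ℕ.+ m)                            ≡⟨ cong (λ i → + fib (2 ℕ.+ i)) (2*[2+n]≡4+2*n n) ⟨
  + fib (2 ℕ.+ 2 ℕ.* suc (suc n))            ∎
  where
  open ≡-Reasoning
  T = tridiag 3 3
  m = 2 ℕ.+ 2 ℕ.* n

det′-tridiag-2-3 : ∀ n → det′ n (tridiag 2 3) ≡ + fib (suc (2 ℕ.* n))
det′-tridiag-2-3 zero          = refl
det′-tridiag-2-3 (suc zero)    = refl
det′-tridiag-2-3 (suc (suc n)) = begin
  det′ (suc (suc n)) (tridiag 2 3)           ≡⟨ det′-tridiag 2 3 n ⟩
  + 2 * det′ (suc n) T - det′ n T            ≡⟨ cong₂ (λ x y → + 2 * x - y) (det′-tridiag-3-3 (suc n)) (det′-tridiag-3-3 n) ⟩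
  + 2 * + fib (2 ℕ.+ 2 ℕ.* suc n) - + fib m  ≡⟨ cong (λ i → + 2 * + fib (2 ℕ.+ i) - + fib m) (2*[1+n]≡2+2*n n) ⟩
  + 2 * + fib (2 ℕ.+ m) - + fib m            ≡⟨ fib-step 2 3 m (fib-+3 m) ⟩
  + fib (3 ℕ.+ m)                            ≡⟨ cong (λ i → + fib (suc i)) (2*[2+n]≡4+2*n n) ⟨
  + fib (suc (2 ℕ.* suc (suc n)))            ∎
  where
  open ≡-Reasoning
  T = tridiag 3 3
  m = 2 ℕ.+ 2 ℕ.* n

-- Catalan and ballot numbers

infixl 7 _⋆_
_⋆_ : (ℕ → ℤ) → (ℕ → ℤ) → ℕ → ℤ
(f ⋆ g) n = ∑[ t < suc n ] (f t * g (n ∸ t))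

⋆-congʳ : ∀ f {g h : ℕ → ℤ} n → (∀ m → g m ≡ h m) → (f ⋆ g) n ≡ (f ⋆ h) n
⋆-congʳ f n g≡h = ∑-cong (suc n) λ t _ → cong (f t *_) (g≡h (n ∸ t))

⋆-distribˡ-- : ∀ f g h n → (f ⋆ (λ m → g m - h m)) n ≡ (f ⋆ g) n - (f ⋆ h) n
⋆-distribˡ-- f g h n =
  ∑-cong (suc n) (λ t _ → *-distribˡ-+ (f t) (g (n ∸ t)) (- h (n ∸ t))
                          ⟨ trans ⟩ cong (_+_ (f t * g (n ∸ t))) (sym (neg-distribʳ-* (f t) (h (n ∸ t)))))
  ⟨ trans ⟩ ∑-distrib-+ (suc n) (λ t → f t * g (n ∸ t)) (λ t → - (f t * h (n ∸ t)))
  ⟨ trans ⟩ cong (_+_ ((f ⋆ g) n)) (sym (neg-distrib-∑ (suc n) (λ t → f t * h (n ∸ t))))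

∑-triangle : ∀ n (F : ℕ → ℕ → ℤ) →
  ∑[ u < suc n ] ∑[ t < suc u ] F t (u ∸ t) ≡ ∑[ t < suc n ] ∑[ s < suc (n ∸ t) ] F t s
∑-triangle zero    F = refl
∑-triangle (suc n) F = begin
  F 0 0 + + 0 + ∑ (suc n) (λ u → F 0 (suc u) + later u)
    ≡⟨ cong (_+_ (F 0 0 + + 0)) (∑-distrib-+ (suc n) (F 0 ∘ suc) later) ⟩
  F 0 0 + + 0 + (∑ (suc n) (F 0 ∘ suc) + ∑ (suc n) later)
    ≡⟨ cong (λ x → F 0 0 + + 0 + (∑ (suc n) (F 0 ∘ suc) + x)) (∑-triangle n (F ∘ suc)) ⟩
  F 0 0 + + 0 + (∑ (suc n) (F 0 ∘ suc) + rest)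
    ≡⟨ lemma (F 0 0) _ _ ⟩
  F 0 0 + ∑ (suc n) (F 0 ∘ suc) + rest
    ∎
  where
  open ≡-Reasoning
  later : ℕ → ℤ
  later u = ∑[ t < suc u ] F (suc t) (u ∸ t)

  rest : ℤ
  rest = ∑[ t < suc n ] ∑[ s < suc (n ∸ t) ] F (suc t) s

  lemma : ∀ x a r → x + + 0 + (a + r) ≡ x + a + r
  lemma = solve-∀

⋆-assoc : ∀ f g h n → ((f ⋆ g) ⋆ h) n ≡ (f ⋆ (g ⋆ h)) n
⋆-assoc f g h n = begin
  ∑[ u < suc n ] ((f ⋆ g) u * h (n ∸ u))
    ≡⟨ ∑-cong (suc n) (λ u _ → *-distribʳ-∑ (suc u) (h (n ∸ u)) (λ t → f t * g (u ∸ t))) ⟩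
  ∑[ u < suc n ] ∑[ t < suc u ] (f t * g (u ∸ t) * h (n ∸ u))
    ≡⟨ ∑-cong (suc n) (λ u u≤n → ∑-cong (suc u) λ t t≤u →
         cong (λ i → f t * g (u ∸ t) * h (n ∸ i)) (sym (ℕₚ.m+[n∸m]≡n (ℕₚ.≤-pred t≤u)))) ⟩
  ∑[ u < suc n ] ∑[ t < suc u ] (f t * g (u ∸ t) * h (n ∸ (t ℕ.+ (u ∸ t))))
    ≡⟨ ∑-triangle n (λ t s → f t * g s * h (n ∸ (t ℕ.+ s))) ⟩
  ∑[ t < suc n ] ∑[ s < suc (n ∸ t) ] (f t * g s * h (n ∸ (t ℕ.+ s)))
    ≡⟨ ∑-cong (suc n) (λ t _ → ∑-cong (suc (n ∸ t)) λ s _ →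
         *-assoc (f t) (g s) _ ⟨ trans ⟩ cong (λ i → f t * (g s * h i)) (sym (ℕₚ.∸-+-assoc n t s))) ⟩
  ∑[ t < suc n ] ∑[ s < suc (n ∸ t) ] (f t * (g s * h (n ∸ t ∸ s)))
    ≡⟨ ∑-cong (suc n) (λ t _ → sym (*-distribˡ-∑ (suc (n ∸ t)) (f t) (λ s → g s * h (n ∸ t ∸ s)))) ⟩
  ∑[ t < suc n ] (f t * (g ⋆ h) (n ∸ t))
    ∎
  where open ≡-Reasoning

Cat : ℕ → ℤ
Cat n = + catalan n

catRev≡applyDownFrom : ∀ n → catRev n ≡ applyDownFrom catalan (suc n)
catRev≡applyDownFrom zero    = refl
catRev≡applyDownFrom (suc n) = cong (catalan (suc n) ∷_) (catRev≡applyDownFrom n)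

reverse-applyDownFrom : ∀ (f : ℕ → ℕ) n → reverse (applyDownFrom f n) ≡ applyUpTo f n
reverse-applyDownFrom f zero    = refl
reverse-applyDownFrom f (suc n) =
  unfold-reverse (f n) (applyDownFrom f n)
  ⟨ trans ⟩ cong (_∷ʳ f n) (reverse-applyDownFrom f n) ⟨ trans ⟩ applyUpTo-∷ʳ f n

applyDownFrom≡applyUpTo : ∀ (f : ℕ → ℕ) n → applyDownFrom f (suc n) ≡ applyUpTo (λ j → f (n ∸ j)) (suc n)
applyDownFrom≡applyUpTo f zero    = refl
applyDownFrom≡applyUpTo f (suc n) = cong (f (suc n) ∷_) (applyDownFrom≡applyUpTo f n)

zipWith-applyUpTo : ∀ (_∙_ : ℕ → ℕ → ℕ) f g n →
  zipWith _∙_ (applyUpTo f n) (applyUpTo g n) ≡ applyUpTo (λ j → f j ∙ g j) n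
zipWith-applyUpTo _∙_ f g zero    = refl
zipWith-applyUpTo _∙_ f g (suc n) = cong (f 0 ∙ g 0 ∷_) (zipWith-applyUpTo _∙_ (f ∘ suc) (g ∘ suc) n)

sum-applyUpTo : ∀ (f : ℕ → ℕ) n → + sum (applyUpTo f n) ≡ ∑[ j < n ] + f j
sum-applyUpTo f zero    = refl
sum-applyUpTo f (suc n) = pos-+ (f 0) _ ⟨ trans ⟩ cong (_+_ (+ f 0)) (sum-applyUpTo (f ∘ suc) n)

catalan-suc : ∀ n → Cat (suc n) ≡ (Cat ⋆ Cat) n
catalan-suc n = begin
  + sum (zipWith ℕ._*_ (catRev n) (reverse (catRev n)))
    ≡⟨ cong (λ xs → + sum (zipWith ℕ._*_ xs (reverse xs))) (catRev≡applyDownFrom n) ⟩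
  + sum (zipWith ℕ._*_ (applyDownFrom catalan (suc n)) (reverse (applyDownFrom catalan (suc n))))
    ≡⟨ cong₂ (λ xs ys → + sum (zipWith ℕ._*_ xs ys))
             (applyDownFrom≡applyUpTo catalan n) (reverse-applyDownFrom catalan (suc n)) ⟩
  + sum (zipWith ℕ._*_ (applyUpTo (λ j → catalan (n ∸ j)) (suc n)) (applyUpTo catalan (suc n)))
    ≡⟨ cong (+_ ∘ sum) (zipWith-applyUpTo ℕ._*_ (λ j → catalan (n ∸ j)) catalan (suc n)) ⟩
  + sum (applyUpTo (λ j → catalan (n ∸ j) ℕ.* catalan j) (suc n))
    ≡⟨ sum-applyUpTo (λ j → catalan (n ∸ j) ℕ.* catalan j) (suc n) ⟩
  ∑[ j < suc n ] + (catalan (n ∸ j) ℕ.* catalan j)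
    ≡⟨ ∑-cong (suc n) (λ j _ → pos-* (catalan (n ∸ j)) (catalan j) ⟨ trans ⟩ *-comm (Cat (n ∸ j)) (Cat j)) ⟩
  (Cat ⋆ Cat) n
    ∎
  where open ≡-Reasoning

-- In generating functions K f = (C − 1) f, where C is the generating function of the Catalan numbers.
K : (ℕ → ℤ) → ℕ → ℤ
K f zero    = + 0
K f (suc n) = ∑[ t < suc n ] (Cat (suc t) * f (n ∸ t))

K≡⋆- : ∀ f n → K f n ≡ (Cat ⋆ f) n - f n
K≡⋆- f zero    = lemma (f 0)
  where
  lemma : ∀ x → + 0 ≡ + 1 * x + + 0 - x
  lemma = solve-∀
K≡⋆- f (suc n) = lemma (f (suc n)) (K f (suc n))
  where
  lemma : ∀ x k → k ≡ + 1 * x + k - x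
  lemma = solve-∀

-- C − 1 = x C², so K f (n + 1) = (C² f) n; expanding C² = 1 + 2 (C − 1) + (C − 1)² gives the recurrence.
K-suc : ∀ f n → K f (suc n) ≡ f n + + 2 * K f n + K (K f) n
K-suc f n = begin
  K f (suc n)                        ≡⟨ ∑-cong (suc n) (λ t _ → cong (_* f (n ∸ t)) (catalan-suc t)) ⟩
  ((Cat ⋆ Cat) ⋆ f) n                ≡⟨ ⋆-assoc Cat Cat f n ⟩
  (Cat ⋆ (Cat ⋆ f)) n                ≡⟨ lemma (f n) ((Cat ⋆ f) n) _ ⟨
  f n + + 2 * ((Cat ⋆ f) n - f n) + (((Cat ⋆ (Cat ⋆ f)) n - (Cat ⋆ f) n) - ((Cat ⋆ f) n - f n))
    ≡⟨ cong₂ (λ x y → f n + + 2 * x + y) (sym (K≡⋆- f n)) (sym K²) ⟩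
  f n + + 2 * K f n + K (K f) n      ∎
  where
  open ≡-Reasoning
  lemma : ∀ x c cc → x + + 2 * (c - x) + ((cc - c) - (c - x)) ≡ cc
  lemma = solve-∀

  K² : K (K f) n ≡ ((Cat ⋆ (Cat ⋆ f)) n - (Cat ⋆ f) n) - ((Cat ⋆ f) n - f n)
  K² = K≡⋆- (K f) n ⟨ trans ⟩ cong₂ _-_
         (⋆-congʳ Cat n (K≡⋆- f) ⟨ trans ⟩ ⋆-distribˡ-- Cat (Cat ⋆ f) f n) (K≡⋆- f n)

-- B n m = [xⁿ] xᵐ C(x)²ᵐ⁺¹, a ballot number.
B : ℕ → ℕ → ℤ
B n zero    = Cat n
B n (suc m) = K (λ i → B i m) n

B-suc-zero : ∀ i → B (suc i) 0 ≡ B i 0 + B i 1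
B-suc-zero i = catalan-suc i ⟨ trans ⟩ lemma (K≡⋆- Cat i)
  where
  lemma : ∀ {c x k} → k ≡ c - x → c ≡ x + k
  lemma {c} {x} refl = solve′ c x
    where
    solve′ : ∀ c x → c ≡ x + (c - x)
    solve′ = solve-∀

B-suc-suc : ∀ i m → B (suc i) (suc m) ≡ B i m + + 2 * B i (suc m) + B i (suc (suc m))
B-suc-suc i m = K-suc (λ n → B n m) i

B-upper : ∀ r m → r < m → B r m ≡ + 0
B-upper zero    (suc m) _         = refl
B-upper (suc r) (suc m) (s≤s r<m) = ∑-zero (suc r) _ λ t _ →
  cong (Cat (suc t) *_) (B-upper (r ∸ t) m (ℕₚ.≤-<-trans (ℕₚ.m∸n≤m r t) r<m))
  ⟨ trans ⟩ *-zeroʳ (Cat (suc t))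

B-diag : ∀ r → B r r ≡ + 1
B-diag zero    = refl
B-diag (suc r) = cong₂ _+_ (cong (Cat 1 *_) (B-diag r)) (∑-zero r _ vanish)
  where
  vanish : ∀ t → t < r → Cat (suc (suc t)) * B (r ∸ suc t) r ≡ + 0
  vanish t t<r = cong (Cat (suc (suc t)) *_) (B-upper (r ∸ suc t) r (ℕₚ.∸-monoʳ-< (s≤s z≤n) t<r))
    ⟨ trans ⟩ *-zeroʳ (Cat (suc (suc t)))

-- The factorisation H + H′ = B (I + J) Bᵀ

tridiag-offDiagonal : ∀ a b a′ b′ r c → r ≢ c → tridiag a b r c ≡ tridiag a′ b′ r c
tridiag-offDiagonal a b a′ b′ (suc r)       (suc c)       r≢c =
  tridiag-offDiagonal b b b′ b′ r c (r≢c ∘ cong suc)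
tridiag-offDiagonal a b a′ b′ zero          zero          r≢c = ⊥-elim (r≢c refl)
tridiag-offDiagonal a b a′ b′ zero          (suc zero)    _   = refl
tridiag-offDiagonal a b a′ b′ zero          (suc (suc c)) _   = refl
tridiag-offDiagonal a b a′ b′ (suc zero)    zero          _   = refl
tridiag-offDiagonal a b a′ b′ (suc (suc r)) zero          _   = refl

∑-tridiag-row₀ : ∀ a b N (v : ℕ → ℤ) → 1 < N → ∑[ j < N ] (tridiag a b 0 j * v j) ≡ + a * v 0 + v 1
∑-tridiag-row₀ a b (suc zero)    v (s≤s ())
∑-tridiag-row₀ a b (suc (suc N)) v _ =
  cong (λ z → + a * v 0 + (+ 1 * v 1 + z)) (∑-zero N _ λ j _ → *-zeroˡ (v (suc (suc j))))
  ⟨ trans ⟩ lemma (+ a * v 0) (v 1)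
  where
  lemma : ∀ x y → x + (+ 1 * y + + 0) ≡ x + y
  lemma = solve-∀

∑-tridiag-row : ∀ a b N m (v : ℕ → ℤ) → suc (suc m) < N →
  ∑[ j < N ] (tridiag a b (suc m) j * v j) ≡ v m + + b * v (suc m) + v (suc (suc m))
∑-tridiag-row a b (suc N) zero    v (s≤s 2<N) =
  cong (_+_ (+ 1 * v 0)) (∑-tridiag-row₀ b b N (v ∘ suc) 2<N) ⟨ trans ⟩ lemma (v 0) (+ b * v 1) (v 2)
  where
  lemma : ∀ x y z → + 1 * x + (y + z) ≡ x + y + z
  lemma = solve-∀
∑-tridiag-row a b (suc N) (suc m) v (s≤s 3+m<N) =
  cong (_+_ (+ 0 * v 0)) (∑-tridiag-row b b N m (v ∘ suc) 3+m<N) ⟨ trans ⟩ lemma (v 0) _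
  where
  lemma : ∀ x y → + 0 * x + y ≡ y
  lemma = solve-∀

-- tridiag (a + 1) (b + 1) is the identity plus tridiag a b.
∑-tridiag-suc : ∀ a b N m (v : ℕ → ℤ) → m < N →
  ∑[ j < N ] (tridiag (suc a) (suc b) m j * v j) ≡ v m + (∑[ j < N ] (tridiag a b m j * v j))
∑-tridiag-suc a b (suc N) zero    v _ =
  cong (_+_ (+ suc a * v 0))
       (∑-cong N λ j _ → cong (_* v (suc j)) (tridiag-offDiagonal (suc a) (suc b) a b 0 (suc j) λ ()))
  ⟨ trans ⟩ lemma (v 0) (+ a) _
  where
  lemma : ∀ x y t → (+ 1 + y) * x + t ≡ x + (y * x + t)
  lemma = solve-∀
∑-tridiag-suc a b (suc N) (suc m) v (s≤s m<N) =
  cong₂ (λ x y → x * v 0 + y)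
        (tridiag-offDiagonal (suc a) (suc b) a b (suc m) 0 λ ()) (∑-tridiag-suc b b N m (v ∘ suc) m<N)
  ⟨ trans ⟩ lemma (tridiag a b (suc m) 0 * v 0) (v (suc m)) _
  where
  lemma : ∀ x y z → x + (y + z) ≡ y + (x + z)
  lemma = solve-∀

B-suc : ∀ N i m → i < N → m < N → B (suc i) m ≡ ∑[ m′ < N ] (tridiag 1 2 m m′ * B i m′)
B-suc N i m i<N m<N =
  sym (byRow m m<N)
  ⟨ trans ⟩ ∑-truncate N (suc N) (λ m′ → tridiag 1 2 m m′ * B i m′) (ℕₚ.n≤1+n N) vanish
  where
  vanish : ∀ m′ → N ≤ m′ → tridiag 1 2 m m′ * B i m′ ≡ + 0
  vanish m′ N≤m′ = cong (tridiag 1 2 m m′ *_) (B-upper i m′ (ℕₚ.<-≤-trans i<N N≤m′))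
                   ⟨ trans ⟩ *-zeroʳ (tridiag 1 2 m m′)

  byRow : ∀ m → m < N → ∑[ m′ < suc N ] (tridiag 1 2 m m′ * B i m′) ≡ B (suc i) m
  byRow zero    m<N = ∑-tridiag-row₀ 1 2 (suc N) (B i) (s≤s m<N)
    ⟨ trans ⟩ cong (_+ B i 1) (*-identityˡ (B i 0)) ⟨ trans ⟩ sym (B-suc-zero i)
  byRow (suc m) m<N = ∑-tridiag-row 1 2 (suc N) m (B i) (s≤s m<N) ⟨ trans ⟩ sym (B-suc-suc i m)

-- tridiag 1 2 is symmetric, so it can be moved from one factor of the Gram sum to the other.
B-gram-shift : ∀ N a b → a < N → b < N →
  ∑[ m < N ] (B (suc a) m * B b m) ≡ ∑[ m < N ] (B a m * B (suc b) m)
B-gram-shift N a b a<N b<N = begin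
  ∑[ m < N ] (B (suc a) m * B b m)
    ≡⟨ ∑-cong N (λ m m<N → cong (_* B b m) (B-suc N a m a<N m<N) ⟨ trans ⟩ *-distribʳ-∑ N (B b m) _) ⟩
  ∑[ m < N ] ∑[ m′ < N ] (J m m′ * B a m′ * B b m)
    ≡⟨ ∑-comm N N _ ⟩
  ∑[ m′ < N ] ∑[ m < N ] (J m m′ * B a m′ * B b m)
    ≡⟨ ∑-cong N (λ m′ _ → ∑-cong N λ m _ →
         cong (λ x → x * B a m′ * B b m) (tridiag-sym 1 2 m m′) ⟨ trans ⟩ lemma (J m′ m) (B a m′) (B b m)) ⟩
  ∑[ m′ < N ] ∑[ m < N ] (B a m′ * (J m′ m * B b m))
    ≡⟨ ∑-cong N (λ m′ m′<N →
         sym (*-distribˡ-∑ N (B a m′) _) ⟨ trans ⟩ cong (B a m′ *_) (sym (B-suc N b m′ b<N m′<N))) ⟩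
  ∑[ m′ < N ] (B a m′ * B (suc b) m′)
    ∎
  where
  open ≡-Reasoning
  J = tridiag 1 2
  lemma : ∀ j x y → j * x * y ≡ x * (j * y)
  lemma = solve-∀

B-gram′ : ∀ N a b → a ℕ.+ b < N → ∑[ m < N ] (B a m * B b m) ≡ Cat (a ℕ.+ b)
B-gram′ N zero    b b<N =
  ∑-single N 0 _ (ℕₚ.≤-<-trans z≤n b<N) (λ { zero _ 0≢0 → ⊥-elim (0≢0 refl) ; (suc m) _ _ → refl })
  ⟨ trans ⟩ *-identityˡ (Cat b)
B-gram′ N (suc a) b 1+a+b<N =
  B-gram-shift N a b (ℕₚ.≤-<-trans (ℕₚ.m≤m+n a b) (ℕₚ.<-trans (ℕₚ.n<1+n _) 1+a+b<N))
                     (ℕₚ.≤-<-trans (ℕₚ.m≤n+m b (suc a)) 1+a+b<N)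
  ⟨ trans ⟩ B-gram′ N a (suc b) (subst (_< N) (sym (ℕₚ.+-suc a b)) 1+a+b<N)
  ⟨ trans ⟩ cong Cat (ℕₚ.+-suc a b)

-- H_k(C) = B Bᵀ; truncating the sum anywhere beyond a loses nothing since B is lower triangular.
B-gram : ∀ N a b → a < N → ∑[ m < N ] (B a m * B b m) ≡ Cat (a ℕ.+ b)
B-gram N a b a<N =
  ∑-truncate (suc a) N _ a<N vanish
  ⟨ trans ⟩ sym (∑-truncate (suc a) (suc (a ℕ.+ b)) _ (s≤s (ℕₚ.m≤m+n a b)) vanish)
  ⟨ trans ⟩ B-gram′ (suc (a ℕ.+ b)) a b ℕₚ.≤-refl
  where
  vanish : ∀ m → suc a ≤ m → B a m * B b m ≡ + 0
  vanish m a<m = cong (_* B b m) (B-upper a m a<m) ⟨ trans ⟩ *-zeroˡ (B b m)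

hankelSum : Mat
hankelSum r c = Cat (r ℕ.+ c) + Cat (suc (r ℕ.+ c))

-- H + H′ = B (I + J) Bᵀ with J = tridiag 1 2, and I + J = tridiag 2 3.
hankelSum≈B·tridiag·Bᵀ : ∀ k → hankelSum ≈[ k ] (B ·[ k ] (tridiag 2 3 ·[ k ] transpose B))
hankelSum≈B·tridiag·Bᵀ k r c r<k c<k = begin
  Cat (r ℕ.+ c) + Cat (suc (r ℕ.+ c))
    ≡⟨ cong₂ _+_ (B-gram k r c r<k) (B-gram k r (suc c) r<k ⟨ trans ⟩ cong Cat (ℕₚ.+-suc r c)) ⟨
  (∑[ m < k ] (B r m * B c m)) + (∑[ m < k ] (B r m * B (suc c) m))
    ≡⟨ ∑-distrib-+ k _ _ ⟨
  ∑[ m < k ] (B r m * B c m + B r m * B (suc c) m)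
    ≡⟨ ∑-cong k (λ m m<k → sym (*-distribˡ-+ (B r m) _ _) ⟨ trans ⟩ cong (B r m *_) (sym (column m m<k))) ⟩
  ∑[ m < k ] (B r m * (tridiag 2 3 ·[ k ] transpose B) m c)
    ∎
  where
  open ≡-Reasoning
  column : ∀ m → m < k → (tridiag 2 3 ·[ k ] transpose B) m c ≡ B c m + B (suc c) m
  column m m<k = ∑-tridiag-suc 1 2 k m (B c) m<k ⟨ trans ⟩ cong (_+_ (B c m)) (sym (B-suc k c m c<k m<k))

proposition4p2 : (k : ℕ) → 1 ≤ k → det k (hankel k ⊕ hankel' k) ≡ + fib (suc (2 ℕ.* k))
proposition4p2 k _ = begin
  det k (hankel k ⊕ hankel' k)                           ≡⟨ det≡det′ k hankelSum ⟩
  det′ k hankelSum                                       ≡⟨ det′-cong k (hankelSum≈B·tridiag·Bᵀ k) ⟩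
  det′ k (B ·[ k ] (tridiag 2 3 ·[ k ] transpose B))     ≡⟨ det′-unitLowerTriangular-· k B _ (λ r _ → B-diag r) B-upper ⟩
  det′ k (tridiag 2 3 ·[ k ] transpose B)                ≡⟨ det′-·-unitUpperTriangular k (tridiag 2 3) (transpose B)
                                                              (λ r _ → B-diag r) (λ r c c<r → B-upper c r c<r) ⟩
  det′ k (tridiag 2 3)                                   ≡⟨ det′-tridiag-2-3 k ⟩
  + fib (suc (2 ℕ.* k))                                  ∎
  where open ≡-Reasoning
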